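{- Let $p$ be a prime, $n\in\mathbb{N}$, $m\ge2$, $\mathbf{a}=(a_0,\dots,a_{m-1})\in\{ -\infty,0,\dots,n\}^m$ and $d\in\mathbb{Z}$ satisfying conditions (I)–(V) below, and write $X=X_{\mathbf{a},d,m}$. Suppose $a_{m-1}\neq-\infty$ and that for some $v\in X$ and $g_0,\dots,g_{m-1}\in R_mG$, $$(\sigma^{p^{a_{m-1}}}-1)v=p^{m-1}\sum_{i=0}^{m-1}g_ix_i.$$ Then $p^{m-1}g_{m-1}$ lies in the ideal $\langle p^{m-1}(\sigma-1)^{p^{a_{m-1}}-1}\rangle$ of $R_mG$. Conditions: (I) $d\in U_1$; (II) $d^{p^{a_i}}\in U_{i+1}$ for all $0\le i<m$; (III) $a_i+j<a_{i+j}$ for all $0\le i<m$ with $1\le j<m-i$ and $a_{i+j}\neq-\infty$, except if $p=2$, $d\notin U_2$, $i=0$ and $a_0=0$, in which case $a_j\neq0$ for all $1\le j<m$; (IV) if $p=2$ and $n=1$ then $a_0=-\infty$; (V) if $p=2$, $m\ge2$, $d\in -U_v\setminus -U_{v+1}$ for some $v\ge2$, and $a_0=0$, then $a_i>i-(v-1)$ for all $i$ with $v\le i<m$ and $a_i\neq-\infty$.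
   Context: $G$ is cyclic of order $p^n$ with generator $\sigma$; $R_m=\mathbb{Z}/p^m\mathbb{Z}$. $U_i=1+p^i\mathbb{Z}$ ($i\in\mathbb{N}$), $U_\infty=\{1\}$, $-U_v=\{ -u:u\in U_v\}$. Conventions: $-\infty<0$, $-\infty+j=-\infty$, $p^{ -\infty}=0$, $\sigma^{p^{ -\infty}}x:=0$. $X_{\mathbf{a},d,m}$ is the $R_mG$-module generated by $y,x_0,\dots,x_{m-1}$ with relations $(\sigma-d)y=\sum_{i=0}^{m-1}p^ix_i$ and $\sigma^{p^{a_i}}x_i=x_i$ ($0\le i<m$), $d$ acting via its image in $R_m$. -}

module Defs where

open import Data.Nat as ℕ using (ℕ; zero; suc; _≤_; _<_; s≤s; z≤n)
open import Data.Integer as ℤ using (ℤ; +_; -_)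
open import Data.Integer.Divisibility using (_∣_)
open import Data.List using (List; []; _∷_; map; replicate; _++_)
open import Data.Fin using (Fin; fromℕ)
import Data.Fin as Fin
open import Data.Product using (Σ; ∃; _×_; _,_)
open import Data.Unit using (⊤)
open import Relation.Binary.PropositionalEquality using (_≡_; _≢_)
open import Relation.Nullary using (¬_)

data Ext : Set where
  -∞  : Ext
  fin : ℕ → Ext

_+ᴱ_ : Ext → ℕ → Ext
-∞      +ᴱ j = -∞
(fin a) +ᴱ j = fin (a ℕ.+ j)

data _<ᴱ_ : Ext → Ext → Set where
  -∞<fin  : ∀ {k} → -∞ <ᴱ fin k
  fin<fin : ∀ {a b} → a < b → fin a <ᴱ fin b

InRange : ℕ → Ext → Set
InRange n -∞      = ⊤
InRange n (fin k) = k ≤ n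

-- p^a as a natural number, with p^{-∞} = 0
pow : ℕ → Ext → ℕ
pow p -∞      = 0
pow p (fin k) = p ℕ.^ k

InU : ℕ → ℕ → ℤ → Set
InU p i d = (+ (p ℕ.^ i)) ∣ (d ℤ.- ℤ.1ℤ)

InNegU : ℕ → ℕ → ℤ → Set
InNegU p i d = InU p i (- d)

-- Integer polynomials ℤ[t] (coefficient lists, lowest degree first)

Poly : Set
Poly = List ℤ

infixl 6 _+ₚ_ _-ₚ_
infixl 7 _*ₚ_

_+ₚ_ : Poly → Poly → Poly
[]      +ₚ g       = g
(a ∷ f) +ₚ []      = a ∷ f
(a ∷ f) +ₚ (b ∷ g) = (a ℤ.+ b) ∷ (f +ₚ g)

negₚ : Poly → Poly
negₚ = map (-_)

_-ₚ_ : Poly → Poly → Poly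
f -ₚ g = f +ₚ negₚ g

scaleₚ : ℤ → Poly → Poly
scaleₚ c = map (c ℤ.*_)

_*ₚ_ : Poly → Poly → Poly
[]      *ₚ g = []
(a ∷ f) *ₚ g = scaleₚ a g +ₚ (ℤ.0ℤ ∷ (f *ₚ g))

constₚ : ℤ → Poly
constₚ c = c ∷ []

0ₚ 1ₚ : Poly
0ₚ = []
1ₚ = constₚ ℤ.1ℤ

-- t^k (t plays the role of σ)
tpow : ℕ → Poly
tpow k = replicate k ℤ.0ℤ ++ (ℤ.1ℤ ∷ [])

t : Poly
t = tpow 1

_^ₚ_ : Poly → ℕ → Poly
f ^ₚ zero  = 1ₚ
f ^ₚ suc k = f *ₚ (f ^ₚ k)

coeff : Poly → ℕ → ℤ
coeff []      k       = ℤ.0ℤ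
coeff (a ∷ f) zero    = a
coeff (a ∷ f) (suc k) = coeff f k

_≈ₚ_ : Poly → Poly → Set
f ≈ₚ g = ∀ k → coeff f k ≡ coeff g k

-- σ^{p^a} as a polynomial, with σ^{p^{-∞}} := 0
σpow : ℕ → Ext → Poly
σpow p -∞      = 0ₚ
σpow p (fin k) = tpow (p ℕ.^ k)

-- The group ring R_m G = (ℤ/p^m)[C_{p^n}] = ℤ[t] / (p^m, t^{p^n} - 1),
-- with elements represented by integer polynomials.

InKer : (p n m : ℕ) → Poly → Set
InKer p n m f = Σ Poly λ q → Σ Poly λ r →
  f ≈ₚ (constₚ (+ (p ℕ.^ m)) *ₚ q +ₚ (tpow (p ℕ.^ n) -ₚ 1ₚ) *ₚ r)

EqG : (p n m : ℕ) → Poly → Poly → Set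
EqG p n m f g = InKer p n m (f -ₚ g)

InIdealG : (p n m : ℕ) → Poly → Poly → Set
InIdealG p n m c f = Σ Poly λ h → EqG p n m f (h *ₚ c)

-- The module X_{a,d,m}: quotient of the free R_m G-module on
-- y, x_0, …, x_{m-1} by the submodule generated by the relations
--   (σ - d) y - Σ_i p^i x_i    and    (σ^{p^{a_i}} - 1) x_i  (0 ≤ i < m).

record Elem (m : ℕ) : Set where
  constructor elem
  field
    ycomp : Poly
    xcomp : Fin m → Poly
open Elem public

_+ₑ_ : ∀ {m} → Elem m → Elem m → Elem m
u +ₑ w = elem (ycomp u +ₚ ycomp w) (λ i → xcomp u i +ₚ xcomp w i)

_-ₑ_ : ∀ {m} → Elem m → Elem m → Elem m
u -ₑ w = elem (ycomp u -ₚ ycomp w) (λ i → xcomp u i -ₚ xcomp w i)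

_·ₑ_ : ∀ {m} → Poly → Elem m → Elem m
f ·ₑ u = elem (f *ₚ ycomp u) (λ i → f *ₚ xcomp u i)

0ₑ : ∀ {m} → Elem m
0ₑ = elem 0ₚ (λ _ → 0ₚ)

sumₑ : ∀ {m k} → (Fin k → Elem m) → Elem m
sumₑ {k = zero}  f = 0ₑ
sumₑ {k = suc k} f = f Fin.zero +ₑ sumₑ (λ i → f (Fin.suc i))

genY : ∀ {m} → Elem m
genY = elem 1ₚ (λ _ → 0ₚ)

genX : ∀ {m} → Fin m → Elem m
genX {m} i = elem 0ₚ (λ j → δ i j)
  where
  δ : ∀ {k} → Fin k → Fin k → Poly
  δ Fin.zero    Fin.zero    = 1ₚ
  δ Fin.zero    (Fin.suc _) = 0ₚ
  δ (Fin.suc _) Fin.zero    = 0ₚ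
  δ (Fin.suc i) (Fin.suc j) = δ i j

relY : (p : ℕ) (d : ℤ) (m : ℕ) → Elem m
relY p d m = ((t -ₚ constₚ d) ·ₑ genY) -ₑ sumₑ (λ i → constₚ (+ (p ℕ.^ Fin.toℕ i)) ·ₑ genX i)

relX : (p : ℕ) {m : ℕ} → (Fin m → Ext) → Fin m → Elem m
relX p a i = (σpow p (a i) -ₚ 1ₚ) ·ₑ genX i

EqFree : (p n m : ℕ) → Elem m → Elem m → Set
EqFree p n m u w = EqG p n m (ycomp u) (ycomp w) × (∀ i → EqG p n m (xcomp u i) (xcomp w i))

InRel : (p n : ℕ) (d : ℤ) (m : ℕ) → (Fin m → Ext) → Elem m → Set
InRel p n d m a u = Σ Poly λ c → Σ (Fin m → Poly) λ s →
  EqFree p n m u ((c ·ₑ relY p d m) +ₑ sumₑ (λ i → s i ·ₑ relX p a i))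

EqX : (p n : ℕ) (d : ℤ) (m : ℕ) → (Fin m → Ext) → Elem m → Elem m → Set
EqX p n d m a u w = InRel p n d m a (u -ₑ w)

CondI : ℕ → ℤ → Set
CondI p d = InU p 1 d

CondII : (p : ℕ) (d : ℤ) (m : ℕ) → (Fin m → Ext) → Set
CondII p d m a = ∀ (i : Fin m) → InU p (suc (Fin.toℕ i)) (d ℤ.^ pow p (a i))

Exc : (p : ℕ) (d : ℤ) {m : ℕ} → (Fin m → Ext) → Fin m → Set
Exc p d a i = (p ≡ 2) × (¬ InU p 2 d) × (Fin.toℕ i ≡ 0) × (a i ≡ fin 0)

CondIII : (p : ℕ) (d : ℤ) (m : ℕ) → (Fin m → Ext) → Set
CondIII p d m a = ∀ (i : Fin m) (j : ℕ) (h : Fin.toℕ i ℕ.+ j < m) → 1 ≤ j →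
  a (Fin.fromℕ< h) ≢ -∞ →
    (Exc p d a i → a (Fin.fromℕ< h) ≢ fin 0) ×
    (¬ Exc p d a i → (a i +ᴱ j) <ᴱ a (Fin.fromℕ< h))

CondIV : (p n : ℕ) {m' : ℕ} → (Fin (suc m') → Ext) → Set
CondIV p n a = p ≡ 2 → n ≡ 1 → a Fin.zero ≡ -∞

CondV : (p : ℕ) (d : ℤ) {m' : ℕ} → (Fin (suc m') → Ext) → Set
CondV p d {m'} a = p ≡ 2 → 2 ≤ suc m' → ∀ (v : ℕ) → 2 ≤ v →
  InNegU p v d → ¬ InNegU p (suc v) d → a Fin.zero ≡ fin 0 →
  ∀ (i : Fin (suc m')) → v ≤ Fin.toℕ i → ∀ (k : ℕ) → a i ≡ fin k →
    ((+ Fin.toℕ i) ℤ.- ((+ v) ℤ.- ℤ.1ℤ)) ℤ.< (+ k)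

-- Work in ℤ[t] modulo p^m and t^(p^n) - 1, with P = p^(m-1), M = p^e,
-- F = t^M - 1 and u = t - 1. If c is the coefficient of the relation
-- (σ - d) y = Σ p^i x_i in the hypothesis, its y- and x_{m-1}-components read
--   F Y ≡ c (t - d)   and   P g ≡ P c + F w.
-- Since t^M - 1 is not a zero divisor modulo an integer, P ∣ F w forces
-- w ≡ P w′. Modulo p we have d ≡ 1 and, by Frobenius, u^M ≡ F; so
-- u (c - u^(M-1) Z) ≡ 0 and, u being cancellable modulo p too, c ≡ u^(M-1) Z.
-- Substituting both, P g ≡ P u^(M-1) (Z + u w′) modulo p^m.

module Submission where

open import Defs

open import Data.Empty using (⊥-elim)
open import Data.Fin as Fin using (Fin; fromℕ; inject₁; toℕ)
import Data.Fin.Properties as FinP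
open import Data.Integer as ℤ using (ℤ; +_; -_)
open import Data.Integer.Divisibility.Signed using (_∣_; divides; ∣m+n∣m⇒∣n; ∣m⇒∣-m; ∣ᵤ⇒∣)
import Data.Integer.Properties as ℤP
open import Data.List using ([]; _∷_)
open import Data.Maybe using (Maybe; just; nothing)
open import Data.Nat as ℕ using (ℕ; zero; suc; _+_; _^_; _∸_; _!; s≤s; z≤n)
open import Data.Nat.Combinatorics using (_C_; nCn≡1; nCk≡n!/k![n-k]!; k![n∸k]!∣n!)
import Data.Nat.Divisibility as ℕ∣
open import Data.Nat.DivMod using (m/n*n≡m)
open import Data.Nat.Induction using (<-rec)
open import Data.Nat.Primality using (Prime; euclidsLemma; ¬prime[0]; ¬prime[1]; prime⇒nonZero)
import Data.Nat.Properties as ℕP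
open import Data.Product using (Σ; _,_; proj₁; proj₂)
open import Data.Sum using (inj₁; inj₂)
open import Function using (_∘_)
open import Relation.Binary.Bundles using (Setoid)
open import Relation.Binary.PropositionalEquality
import Relation.Binary.Reasoning.Setoid as ≈-Reasoning
open import Relation.Nullary using (¬_; yes; no)

open import Algebra.Bundles using (CommutativeRing)
open import Algebra.Properties.CommutativeSemigroup ℤP.+-commutativeSemigroup
  using (interchange; x∙yz≈y∙xz)
import Algebra.Properties.CommutativeSemiring.Binomial as Binomial
import Algebra.Properties.Monoid.Sum as Sum
import Algebra.Properties.Semiring.Exp as Exp
import Algebra.Properties.Semiring.Mult as Mult
import Algebra.Solver.Ring
open import Algebra.Solver.Ring.AlmostCommutativeRing
  using (fromCommutativeRing; _-Raw-AlmostCommutative⟶_)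

Seq : Set
Seq = ℕ → ℤ

infixl 7 _⋆_

_⋆_ : Seq → Seq → Seq
(F ⋆ G) zero    = F 0 ℤ.* G 0
(F ⋆ G) (suc k) = F 0 ℤ.* G (suc k) ℤ.+ (F ∘ suc ⋆ G) k

⋆-cong : ∀ {F F′ G G′} → F ≗ F′ → G ≗ G′ → F ⋆ G ≗ F′ ⋆ G′
⋆-cong eF eG zero    = cong₂ ℤ._*_ (eF 0) (eG 0)
⋆-cong eF eG (suc k) = cong₂ ℤ._+_ (cong₂ ℤ._*_ (eF 0) (eG (suc k))) (⋆-cong (eF ∘ suc) eG k)

⋆-zeroˡ : ∀ G → (λ _ → ℤ.0ℤ) ⋆ G ≗ (λ _ → ℤ.0ℤ)
⋆-zeroˡ G zero    = refl
⋆-zeroˡ G (suc k) = trans (ℤP.+-identityˡ _) (⋆-zeroˡ G k)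

⋆-distribʳ-+ : ∀ F F′ G → (λ i → F i ℤ.+ F′ i) ⋆ G ≗ (λ k → (F ⋆ G) k ℤ.+ (F′ ⋆ G) k)
⋆-distribʳ-+ F F′ G zero    = ℤP.*-distribʳ-+ (G 0) (F 0) (F′ 0)
⋆-distribʳ-+ F F′ G (suc k) = trans
  (cong₂ ℤ._+_ (ℤP.*-distribʳ-+ (G (suc k)) (F 0) (F′ 0)) (⋆-distribʳ-+ (F ∘ suc) (F′ ∘ suc) G k))
  (interchange (F 0 ℤ.* G (suc k)) _ ((F ∘ suc ⋆ G) k) _)

⋆-distribˡ-+ : ∀ F G G′ → F ⋆ (λ i → G i ℤ.+ G′ i) ≗ (λ k → (F ⋆ G) k ℤ.+ (F ⋆ G′) k)
⋆-distribˡ-+ F G G′ zero    = ℤP.*-distribˡ-+ (F 0) (G 0) (G′ 0)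
⋆-distribˡ-+ F G G′ (suc k) = trans
  (cong₂ ℤ._+_ (ℤP.*-distribˡ-+ (F 0) (G (suc k)) (G′ (suc k))) (⋆-distribˡ-+ (F ∘ suc) G G′ k))
  (interchange (F 0 ℤ.* G (suc k)) _ ((F ∘ suc ⋆ G) k) _)

⋆-scaleˡ : ∀ c F G → (λ i → c ℤ.* F i) ⋆ G ≗ (λ k → c ℤ.* (F ⋆ G) k)
⋆-scaleˡ c F G zero    = ℤP.*-assoc c (F 0) (G 0)
⋆-scaleˡ c F G (suc k) = trans
  (cong₂ ℤ._+_ (ℤP.*-assoc c (F 0) (G (suc k))) (⋆-scaleˡ c (F ∘ suc) G k))
  (sym (ℤP.*-distribˡ-+ c _ _))

⋆-sucʳ : ∀ F G k → (F ⋆ G) (suc k) ≡ F (suc k) ℤ.* G 0 ℤ.+ (F ⋆ G ∘ suc) k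
⋆-sucʳ F G zero    = ℤP.+-comm (F 0 ℤ.* G 1) (F 1 ℤ.* G 0)
⋆-sucʳ F G (suc k) = trans
  (cong (ℤ._+_ (F 0 ℤ.* G (suc (suc k)))) (⋆-sucʳ (F ∘ suc) G k))
  (x∙yz≈y∙xz (F 0 ℤ.* G (suc (suc k))) (F (suc (suc k)) ℤ.* G 0) ((F ∘ suc ⋆ G ∘ suc) k))

⋆-comm : ∀ F G → F ⋆ G ≗ G ⋆ F
⋆-comm F G zero    = ℤP.*-comm (F 0) (G 0)
⋆-comm F G (suc k) = trans
  (cong₂ ℤ._+_ (ℤP.*-comm (F 0) (G (suc k))) (⋆-comm (F ∘ suc) G k))
  (sym (⋆-sucʳ G F k))

⋆-assoc : ∀ F G H → (F ⋆ G) ⋆ H ≗ F ⋆ (G ⋆ H)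
⋆-assoc F G H zero    = ℤP.*-assoc (F 0) (G 0) (H 0)
⋆-assoc F G H (suc k) = begin
  ((F ⋆ G) ⋆ H) (suc k)
    ≡⟨ ⋆-cong split (λ _ → refl) (suc k) ⟩
  ((λ i → F 0 ℤ.* G i ℤ.+ S i) ⋆ H) (suc k)
    ≡⟨ ⋆-distribʳ-+ (λ i → F 0 ℤ.* G i) S H (suc k) ⟩
  ((λ i → F 0 ℤ.* G i) ⋆ H) (suc k) ℤ.+ (S ⋆ H) (suc k)
    ≡⟨ cong₂ ℤ._+_ (⋆-scaleˡ (F 0) G H (suc k)) (ℤP.+-identityˡ _) ⟩
  F 0 ℤ.* (G ⋆ H) (suc k) ℤ.+ ((F ∘ suc ⋆ G) ⋆ H) k
    ≡⟨ cong (ℤ._+_ (F 0 ℤ.* (G ⋆ H) (suc k))) (⋆-assoc (F ∘ suc) G H k) ⟩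
  (F ⋆ (G ⋆ H)) (suc k) ∎
  where
  open ≡-Reasoning
  S : Seq
  S zero    = ℤ.0ℤ
  S (suc i) = (F ∘ suc ⋆ G) i
  split : F ⋆ G ≗ (λ i → F 0 ℤ.* G i ℤ.+ S i)
  split zero    = sym (ℤP.+-identityʳ _)
  split (suc i) = refl

⋆-identityˡ : ∀ G → coeff 1ₚ ⋆ G ≗ G
⋆-identityˡ G zero    = ℤP.*-identityˡ (G 0)
⋆-identityˡ G (suc k) = trans (cong₂ ℤ._+_ (ℤP.*-identityˡ (G (suc k))) (⋆-zeroˡ G k)) (ℤP.+-identityʳ _)

-- ℤ[t] as a commutative ring

coeff-+ₚ : ∀ f g → coeff (f +ₚ g) ≗ (λ k → coeff f k ℤ.+ coeff g k)
coeff-+ₚ []      g       k       = sym (ℤP.+-identityˡ _)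
coeff-+ₚ (a ∷ f) []      k       = sym (ℤP.+-identityʳ _)
coeff-+ₚ (a ∷ f) (b ∷ g) zero    = refl
coeff-+ₚ (a ∷ f) (b ∷ g) (suc k) = coeff-+ₚ f g k

coeff-negₚ : ∀ f → coeff (negₚ f) ≗ (λ k → - coeff f k)
coeff-negₚ []      k       = refl
coeff-negₚ (a ∷ f) zero    = refl
coeff-negₚ (a ∷ f) (suc k) = coeff-negₚ f k

coeff-scaleₚ : ∀ c f → coeff (scaleₚ c f) ≗ (λ k → c ℤ.* coeff f k)
coeff-scaleₚ c []      k       = sym (ℤP.*-zeroʳ c)
coeff-scaleₚ c (a ∷ f) zero    = refl
coeff-scaleₚ c (a ∷ f) (suc k) = coeff-scaleₚ c f k

coeff-*ₚ : ∀ f g → coeff (f *ₚ g) ≗ coeff f ⋆ coeff g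
coeff-*ₚ []      g k       = sym (⋆-zeroˡ (coeff g) k)
coeff-*ₚ (a ∷ f) g zero    = trans (coeff-+ₚ (scaleₚ a g) (ℤ.0ℤ ∷ (f *ₚ g)) zero)
  (trans (ℤP.+-identityʳ _) (coeff-scaleₚ a g zero))
coeff-*ₚ (a ∷ f) g (suc k) = trans (coeff-+ₚ (scaleₚ a g) (ℤ.0ℤ ∷ (f *ₚ g)) (suc k))
  (cong₂ ℤ._+_ (coeff-scaleₚ a g (suc k)) (coeff-*ₚ f g k))

coeff-constₚ*ₚ : ∀ c f → coeff (constₚ c *ₚ f) ≗ (λ k → c ℤ.* coeff f k)
coeff-constₚ*ₚ c f k = trans (coeff-*ₚ (constₚ c) f k) (const⋆ (coeff f) k)
  where
  const⋆ : ∀ G → coeff (constₚ c) ⋆ G ≗ (λ k → c ℤ.* G k)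
  const⋆ G zero    = refl
  const⋆ G (suc k) = trans (cong (ℤ._+_ (c ℤ.* G (suc k))) (⋆-zeroˡ G k)) (ℤP.+-identityʳ _)

coeff-0∷*ₚ : ∀ f W i → coeff ((ℤ.0ℤ ∷ f) *ₚ W) (suc i) ≡ coeff (f *ₚ W) i
coeff-0∷*ₚ f W i = trans (coeff-*ₚ (ℤ.0ℤ ∷ f) W (suc i))
  (trans (ℤP.+-identityˡ _) (sym (coeff-*ₚ f W i)))

-- _≈ₚ_ unfolds to a Π-type, from which Agda cannot infer the polynomials; this
-- record wrapper makes them inferable, so the ring below is built on it.
infix 4 _≃_

record _≃_ (f g : Poly) : Set where
  constructor coeffwise
  field coeffwise-≡ : f ≈ₚ g

open _≃_ public

+ₚ-cong : ∀ {f f′ g g′} → f ≃ f′ → g ≃ g′ → f +ₚ g ≃ f′ +ₚ g′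
+ₚ-cong {f} {f′} {g} {g′} (coeffwise e) (coeffwise e′) = coeffwise λ k →
  trans (coeff-+ₚ f g k) (trans (cong₂ ℤ._+_ (e k) (e′ k)) (sym (coeff-+ₚ f′ g′ k)))

negₚ-cong : ∀ {f f′} → f ≃ f′ → negₚ f ≃ negₚ f′
negₚ-cong {f} {f′} (coeffwise e) = coeffwise λ k →
  trans (coeff-negₚ f k) (trans (cong -_ (e k)) (sym (coeff-negₚ f′ k)))

*ₚ-cong : ∀ {f f′ g g′} → f ≃ f′ → g ≃ g′ → f *ₚ g ≃ f′ *ₚ g′
*ₚ-cong {f} {f′} {g} {g′} (coeffwise e) (coeffwise e′) = coeffwise λ k →
  trans (coeff-*ₚ f g k) (trans (⋆-cong e e′ k) (sym (coeff-*ₚ f′ g′ k)))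

+ₚ-assoc : ∀ f g h → (f +ₚ g) +ₚ h ≃ f +ₚ (g +ₚ h)
+ₚ-assoc f g h = coeffwise λ k → begin
  coeff ((f +ₚ g) +ₚ h) k                  ≡⟨ coeff-+ₚ (f +ₚ g) h k ⟩
  coeff (f +ₚ g) k ℤ.+ coeff h k           ≡⟨ cong (ℤ._+ coeff h k) (coeff-+ₚ f g k) ⟩
  coeff f k ℤ.+ coeff g k ℤ.+ coeff h k    ≡⟨ ℤP.+-assoc (coeff f k) _ _ ⟩
  coeff f k ℤ.+ (coeff g k ℤ.+ coeff h k)  ≡⟨ cong (ℤ._+_ (coeff f k)) (coeff-+ₚ g h k) ⟨
  coeff f k ℤ.+ coeff (g +ₚ h) k           ≡⟨ coeff-+ₚ f (g +ₚ h) k ⟨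
  coeff (f +ₚ (g +ₚ h)) k                  ∎
  where open ≡-Reasoning

+ₚ-comm : ∀ f g → f +ₚ g ≃ g +ₚ f
+ₚ-comm f g = coeffwise λ k → trans (coeff-+ₚ f g k) (trans (ℤP.+-comm (coeff f k) _) (sym (coeff-+ₚ g f k)))

+ₚ-identityʳ : ∀ f → f +ₚ 0ₚ ≃ f
+ₚ-identityʳ f = coeffwise λ k → trans (coeff-+ₚ f [] k) (ℤP.+-identityʳ _)

-ₚ-inverseˡ : ∀ f → negₚ f +ₚ f ≃ 0ₚ
-ₚ-inverseˡ f = coeffwise λ k → trans (coeff-+ₚ (negₚ f) f k)
  (trans (cong (ℤ._+ coeff f k) (coeff-negₚ f k)) (ℤP.+-inverseˡ (coeff f k)))

-ₚ-inverseʳ : ∀ f → f +ₚ negₚ f ≃ 0ₚ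
-ₚ-inverseʳ f = coeffwise λ k → trans (coeffwise-≡ (+ₚ-comm f (negₚ f)) k) (coeffwise-≡ (-ₚ-inverseˡ f) k)

*ₚ-assoc : ∀ f g h → (f *ₚ g) *ₚ h ≃ f *ₚ (g *ₚ h)
*ₚ-assoc f g h = coeffwise λ k → begin
  coeff ((f *ₚ g) *ₚ h) k                  ≡⟨ coeff-*ₚ (f *ₚ g) h k ⟩
  (coeff (f *ₚ g) ⋆ coeff h) k             ≡⟨ ⋆-cong (coeff-*ₚ f g) (λ _ → refl) k ⟩
  ((coeff f ⋆ coeff g) ⋆ coeff h) k        ≡⟨ ⋆-assoc (coeff f) (coeff g) (coeff h) k ⟩
  (coeff f ⋆ (coeff g ⋆ coeff h)) k        ≡⟨ ⋆-cong (λ _ → refl) (coeff-*ₚ g h) k ⟨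
  (coeff f ⋆ coeff (g *ₚ h)) k             ≡⟨ coeff-*ₚ f (g *ₚ h) k ⟨
  coeff (f *ₚ (g *ₚ h)) k                  ∎
  where open ≡-Reasoning

*ₚ-comm : ∀ f g → f *ₚ g ≃ g *ₚ f
*ₚ-comm f g = coeffwise λ k → trans (coeff-*ₚ f g k) (trans (⋆-comm (coeff f) (coeff g) k) (sym (coeff-*ₚ g f k)))

*ₚ-identityˡ : ∀ f → 1ₚ *ₚ f ≃ f
*ₚ-identityˡ f = coeffwise λ k → trans (coeff-*ₚ 1ₚ f k) (⋆-identityˡ (coeff f) k)

*ₚ-identityʳ : ∀ f → f *ₚ 1ₚ ≃ f
*ₚ-identityʳ f = coeffwise λ k → trans (coeffwise-≡ (*ₚ-comm f 1ₚ) k) (coeffwise-≡ (*ₚ-identityˡ f) k)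

*ₚ-distribˡ-+ₚ : ∀ f g h → f *ₚ (g +ₚ h) ≃ f *ₚ g +ₚ f *ₚ h
*ₚ-distribˡ-+ₚ f g h = coeffwise λ k → begin
  coeff (f *ₚ (g +ₚ h)) k
    ≡⟨ coeff-*ₚ f (g +ₚ h) k ⟩
  (coeff f ⋆ coeff (g +ₚ h)) k
    ≡⟨ ⋆-cong (λ _ → refl) (coeff-+ₚ g h) k ⟩
  (coeff f ⋆ (λ i → coeff g i ℤ.+ coeff h i)) k
    ≡⟨ ⋆-distribˡ-+ (coeff f) (coeff g) (coeff h) k ⟩
  (coeff f ⋆ coeff g) k ℤ.+ (coeff f ⋆ coeff h) k
    ≡⟨ cong₂ ℤ._+_ (coeff-*ₚ f g k) (coeff-*ₚ f h k) ⟨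
  coeff (f *ₚ g) k ℤ.+ coeff (f *ₚ h) k
    ≡⟨ coeff-+ₚ (f *ₚ g) (f *ₚ h) k ⟨
  coeff ((f *ₚ g) +ₚ (f *ₚ h)) k ∎
  where open ≡-Reasoning

*ₚ-distribʳ-+ₚ : ∀ h f g → (f +ₚ g) *ₚ h ≃ f *ₚ h +ₚ g *ₚ h
*ₚ-distribʳ-+ₚ h f g = coeffwise λ k → trans (coeffwise-≡ (*ₚ-comm (f +ₚ g) h) k)
  (trans (coeffwise-≡ (*ₚ-distribˡ-+ₚ h f g) k) (coeffwise-≡ (+ₚ-cong (*ₚ-comm h f) (*ₚ-comm h g)) k))

Poly-commutativeRing : CommutativeRing _ _
Poly-commutativeRing = record
  { Carrier = Poly ; _≈_ = _≃_ ; _+_ = _+ₚ_ ; _*_ = _*ₚ_ ; -_ = negₚ ; 0# = 0ₚ ; 1# = 1ₚ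
  ; isCommutativeRing = record
    { isRing = record
      { +-isAbelianGroup = record
        { isGroup = record
          { isMonoid = record
            { isSemigroup = record
              { isMagma = record
                { isEquivalence = record
                  { refl  = coeffwise (λ _ → refl)
                  ; sym   = λ e → coeffwise (λ k → sym (coeffwise-≡ e k))
                  ; trans = λ e e′ → coeffwise (λ k → trans (coeffwise-≡ e k) (coeffwise-≡ e′ k)) }
                ; ∙-cong = +ₚ-cong }
              ; assoc = +ₚ-assoc }
            ; identity = (λ _ → coeffwise (λ _ → refl)) , +ₚ-identityʳ }
          ; inverse = -ₚ-inverseˡ , -ₚ-inverseʳ
          ; ⁻¹-cong = negₚ-cong }
        ; comm = +ₚ-comm }
      ; *-cong = *ₚ-cong
      ; *-assoc = *ₚ-assoc
      ; *-identity = *ₚ-identityˡ , *ₚ-identityʳ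
      ; distrib = *ₚ-distribˡ-+ₚ , *ₚ-distribʳ-+ₚ }
    ; *-comm = *ₚ-comm } }

open CommutativeRing Poly-commutativeRing using ()
  renaming ( setoid to ≃-setoid; refl to ≃-refl; reflexive to ≃-reflexive
           ; sym to ≃-sym; trans to ≃-trans; zeroʳ to *ₚ-zeroʳ )

module ≃-Reasoning = ≈-Reasoning ≃-setoid

constₚ-homomorphism :
  CommutativeRing.rawRing ℤP.+-*-commutativeRing
    -Raw-AlmostCommutative⟶ fromCommutativeRing Poly-commutativeRing
constₚ-homomorphism = record
  { ⟦_⟧    = constₚ
  ; +-homo = λ _ _ → ≃-refl
  ; *-homo = λ a b → coeffwise λ { zero → sym (ℤP.+-identityʳ (a ℤ.* b)) ; (suc _) → refl }
  ; -‿homo = λ _ → ≃-refl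
  ; 0-homo = coeffwise λ { zero → refl ; (suc _) → refl }
  ; 1-homo = ≃-refl }

constₚ-≟ : ∀ a b → Maybe (constₚ a ≃ constₚ b)
constₚ-≟ a b with a ℤ.≟ b
... | yes refl = just ≃-refl
... | no _     = nothing

open Algebra.Solver.Ring _ (fromCommutativeRing Poly-commutativeRing) constₚ-homomorphism constₚ-≟
  using (solve; _:+_; _:-_; _:*_; :-_; _:=_; con)

constₚ-* : ∀ a b → constₚ (a ℤ.* b) ≃ constₚ a *ₚ constₚ b
constₚ-* = _-Raw-AlmostCommutative⟶_.*-homo constₚ-homomorphism

0ₚ≃constₚ0 : 0ₚ ≃ constₚ ℤ.0ℤ
0ₚ≃constₚ0 = coeffwise λ { zero → refl ; (suc _) → refl }

infix 4 _≡_mod_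

-- A record for the same inference reason as _≃_.
record _≡_mod_ (f g c : Poly) : Set where
  constructor congruent
  field
    quotient : Poly
    equality : f -ₚ g ≃ c *ₚ quotient

module _ {c : Poly} where

  ≃⇒≡mod : ∀ {f g} → f ≃ g → f ≡ g mod c
  ≃⇒≡mod {f} {g} f≃g = congruent (constₚ ℤ.0ℤ) (begin
    f -ₚ g                 ≈⟨ +ₚ-cong f≃g ≃-refl ⟩
    g -ₚ g                 ≈⟨ solve 2 (λ g c → g :- g := c :* con ℤ.0ℤ) ≃-refl g c ⟩
    c *ₚ constₚ ℤ.0ℤ       ∎)
    where open ≃-Reasoning

  ≡mod-refl : ∀ {f} → f ≡ f mod c
  ≡mod-refl = ≃⇒≡mod ≃-refl

  ≡mod-sym : ∀ {f g} → f ≡ g mod c → g ≡ f mod c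
  ≡mod-sym {f} {g} (congruent h e) = congruent (negₚ h) (begin
    g -ₚ f            ≈⟨ solve 2 (λ f g → g :- f := :- (f :- g)) ≃-refl f g ⟩
    negₚ (f -ₚ g)     ≈⟨ negₚ-cong e ⟩
    negₚ (c *ₚ h)     ≈⟨ solve 2 (λ c h → :- (c :* h) := c :* (:- h)) ≃-refl c h ⟩
    c *ₚ negₚ h       ∎)
    where open ≃-Reasoning

  ≡mod-trans : ∀ {f g e} → f ≡ g mod c → g ≡ e mod c → f ≡ e mod c
  ≡mod-trans {f} {g} {e} (congruent h fg) (congruent h′ ge) = congruent (h +ₚ h′) (begin
    f -ₚ e
      ≈⟨ solve 3 (λ f g e → f :- e := (f :- g) :+ (g :- e)) ≃-refl f g e ⟩
    (f -ₚ g) +ₚ (g -ₚ e)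
      ≈⟨ +ₚ-cong fg ge ⟩
    c *ₚ h +ₚ c *ₚ h′
      ≈⟨ solve 3 (λ c h h′ → c :* h :+ c :* h′ := c :* (h :+ h′)) ≃-refl c h h′ ⟩
    c *ₚ (h +ₚ h′) ∎)
    where open ≃-Reasoning

  ≡mod-+-cong : ∀ {f f′ g g′} → f ≡ f′ mod c → g ≡ g′ mod c → f +ₚ g ≡ f′ +ₚ g′ mod c
  ≡mod-+-cong {f} {f′} {g} {g′} (congruent h ff′) (congruent h′ gg′) = congruent (h +ₚ h′) (begin
    (f +ₚ g) -ₚ (f′ +ₚ g′)
      ≈⟨ solve 4 (λ f f′ g g′ → (f :+ g) :- (f′ :+ g′) := (f :- f′) :+ (g :- g′)) ≃-refl f f′ g g′ ⟩
    (f -ₚ f′) +ₚ (g -ₚ g′)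
      ≈⟨ +ₚ-cong ff′ gg′ ⟩
    c *ₚ h +ₚ c *ₚ h′
      ≈⟨ solve 3 (λ c h h′ → c :* h :+ c :* h′ := c :* (h :+ h′)) ≃-refl c h h′ ⟩
    c *ₚ (h +ₚ h′) ∎)
    where open ≃-Reasoning

  ≡mod-*-cong : ∀ {f f′ g g′} → f ≡ f′ mod c → g ≡ g′ mod c → f *ₚ g ≡ f′ *ₚ g′ mod c
  ≡mod-*-cong {f} {f′} {g} {g′} (congruent h ff′) (congruent h′ gg′) = congruent (g *ₚ h +ₚ f′ *ₚ h′) (begin
    f *ₚ g -ₚ f′ *ₚ g′
      ≈⟨ solve 4 (λ f f′ g g′ → f :* g :- f′ :* g′ := g :* (f :- f′) :+ f′ :* (g :- g′)) ≃-refl f f′ g g′ ⟩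
    g *ₚ (f -ₚ f′) +ₚ f′ *ₚ (g -ₚ g′)
      ≈⟨ +ₚ-cong (*ₚ-cong (≃-refl {g}) ff′) (*ₚ-cong (≃-refl {f′}) gg′) ⟩
    g *ₚ (c *ₚ h) +ₚ f′ *ₚ (c *ₚ h′)
      ≈⟨ solve 5 (λ c g h f′ h′ → g :* (c :* h) :+ f′ :* (c :* h′) := c :* (g :* h :+ f′ :* h′)) ≃-refl c g h f′ h′ ⟩
    c *ₚ (g *ₚ h +ₚ f′ *ₚ h′) ∎)
    where open ≃-Reasoning

  ≡mod-neg-cong : ∀ {f g} → f ≡ g mod c → negₚ f ≡ negₚ g mod c
  ≡mod-neg-cong {f} {g} (congruent h e) = congruent (negₚ h) (begin
    negₚ f -ₚ negₚ g      ≈⟨ solve 2 (λ f g → :- f :- :- g := :- (f :- g)) ≃-refl f g ⟩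
    negₚ (f -ₚ g)         ≈⟨ negₚ-cong e ⟩
    negₚ (c *ₚ h)         ≈⟨ solve 2 (λ c h → :- (c :* h) := c :* (:- h)) ≃-refl c h ⟩
    c *ₚ negₚ h           ∎)
    where open ≃-Reasoning

  ≡mod-^-cong : ∀ {f g} n → f ≡ g mod c → f ^ₚ n ≡ g ^ₚ n mod c
  ≡mod-^-cong zero    f≡g = ≡mod-refl
  ≡mod-^-cong (suc n) f≡g = ≡mod-*-cong f≡g (≡mod-^-cong n f≡g)

  ≡mod-setoid : Setoid _ _
  ≡mod-setoid = record
    { Carrier = Poly ; _≈_ = λ f g → f ≡ g mod c
    ; isEquivalence = record { refl = ≡mod-refl ; sym = ≡mod-sym ; trans = ≡mod-trans } }

≡mod⇒≃ : ∀ {c f g} (f≡g : f ≡ g mod c) → f ≃ g +ₚ c *ₚ _≡_mod_.quotient f≡g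
≡mod⇒≃ {c} {f} {g} (congruent h e) = begin
  f                     ≈⟨ solve 2 (λ f g → f := g :+ (f :- g)) ≃-refl f g ⟩
  g +ₚ (f -ₚ g)         ≈⟨ +ₚ-cong (≃-refl {g}) e ⟩
  g +ₚ c *ₚ h           ∎
  where open ≃-Reasoning

-≡0⇒≡ : ∀ {c f g} → f -ₚ g ≡ 0ₚ mod c → f ≡ g mod c
-≡0⇒≡ (congruent h e) = congruent h (≃-trans (≃-sym (+ₚ-identityʳ _)) e)

≡mod-divisor : ∀ {c c′ f g} a → c ≃ a *ₚ c′ → f ≡ g mod c → f ≡ g mod c′
≡mod-divisor {c} {c′} {f} {g} a c≃ac′ (congruent h e) = congruent (a *ₚ h) (begin
  f -ₚ g            ≈⟨ e ⟩
  c *ₚ h            ≈⟨ *ₚ-cong c≃ac′ (≃-refl {h}) ⟩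
  (a *ₚ c′) *ₚ h    ≈⟨ solve 3 (λ a c′ h → (a :* c′) :* h := c′ :* (a :* h)) ≃-refl a c′ h ⟩
  c′ *ₚ (a *ₚ h)    ∎)
  where open ≃-Reasoning

≡mod-*ʳ : ∀ {c f g} a → f ≡ g mod c → f *ₚ a ≡ g *ₚ a mod c *ₚ a
≡mod-*ʳ {c} {f} {g} a (congruent h e) = congruent h (begin
  f *ₚ a -ₚ g *ₚ a  ≈⟨ solve 3 (λ a f g → f :* a :- g :* a := (f :- g) :* a) ≃-refl a f g ⟩
  (f -ₚ g) *ₚ a     ≈⟨ *ₚ-cong e (≃-refl {a}) ⟩
  (c *ₚ h) *ₚ a     ≈⟨ solve 3 (λ a c h → (c :* h) :* a := (c :* a) :* h) ≃-refl a c h ⟩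
  (c *ₚ a) *ₚ h     ∎)
  where open ≃-Reasoning

multiple≡0 : ∀ c h → c *ₚ h ≡ 0ₚ mod c
multiple≡0 c h = congruent h (+ₚ-identityʳ (c *ₚ h))

-- In these chains ≈⟨_⟩ steps are congruences modulo c, ≃⟨_⟩ steps equalities in ℤ[t].
module ≡mod-Reasoning (c : Poly) where
  open ≈-Reasoning (≡mod-setoid {c}) public

  infixr 2 step-≃
  step-≃ : ∀ f {g h} → g IsRelatedTo h → f ≃ g → f IsRelatedTo h
  step-≃ f g∼h f≃g = step-≈-⟩ f g∼h (≃⇒≡mod f≃g)
  syntax step-≃ f g∼h f≃g = f ≃⟨ f≃g ⟩ g∼h

≡mod-resp-≃ : ∀ {c f f′ g g′} → f ≃ f′ → g ≃ g′ → f ≡ g mod c → f′ ≡ g′ mod c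
≡mod-resp-≃ f≃f′ g≃g′ f≡g = ≡mod-trans (≃⇒≡mod (≃-sym f≃f′)) (≡mod-trans f≡g (≃⇒≡mod g≃g′))

constₚ-≡mod : ∀ {D a b} → D ∣ a ℤ.- b → constₚ a ≡ constₚ b mod constₚ D
constₚ-≡mod {D} (divides q eq) =
  congruent (constₚ q) (≃-trans (≃-reflexive (cong constₚ (trans eq (ℤP.*-comm q D)))) (constₚ-* D q))

constₚ-p^suc : ∀ p l → constₚ (+ (p ^ suc l)) ≃ constₚ (+ p) *ₚ constₚ (+ (p ^ l))
constₚ-p^suc p l = ≃-trans (≃-reflexive (cong constₚ (ℤP.pos-* p (p ^ l)))) (constₚ-* (+ p) (+ (p ^ l)))

t-d≡t-1 : ∀ p d → CondI p d → t -ₚ constₚ d ≡ t -ₚ 1ₚ mod constₚ (+ p)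
t-d≡t-1 p d d∈U₁ = ≡mod-+-cong (≡mod-refl {f = t}) (≡mod-neg-cong (constₚ-≡mod {a = d} {b = ℤ.1ℤ} p∣d-1))
  where
  p∣d-1 : + p ∣ d ℤ.- ℤ.1ℤ
  p∣d-1 = subst (λ D → D ∣ d ℤ.- ℤ.1ℤ) (cong +_ (ℕP.*-identityʳ p)) (∣ᵤ⇒∣ d∈U₁)

open Exp (CommutativeRing.semiring Poly-commutativeRing) using (^-assocʳ) renaming (_^_ to _^ᴿ_)

^ₚ≡^ᴿ : ∀ f n → f ^ₚ n ≡ f ^ᴿ n
^ₚ≡^ᴿ f zero    = refl
^ₚ≡^ᴿ f (suc n) = cong (f *ₚ_) (^ₚ≡^ᴿ f n)

1ₚ^ₚ : ∀ n → 1ₚ ^ₚ n ≃ 1ₚ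
1ₚ^ₚ zero    = ≃-refl
1ₚ^ₚ (suc n) = ≃-trans (*ₚ-identityˡ (1ₚ ^ₚ n)) (1ₚ^ₚ n)

^ₚ-congˡ : ∀ {f g} n → f ≃ g → f ^ₚ n ≃ g ^ₚ n
^ₚ-congˡ zero    f≃g = ≃-refl
^ₚ-congˡ (suc n) f≃g = *ₚ-cong f≃g (^ₚ-congˡ n f≃g)

^ₚ-assocʳ : ∀ f m n → (f ^ₚ m) ^ₚ n ≃ f ^ₚ (m ℕ.* n)
^ₚ-assocʳ f m n
  rewrite ^ₚ≡^ᴿ (f ^ₚ m) n | ^ₚ≡^ᴿ f m | ^ₚ≡^ᴿ f (m ℕ.* n) = ^-assocʳ f m n

tpow≃t^ₚ : ∀ M → tpow M ≃ t ^ₚ M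
tpow≃t^ₚ zero    = ≃-refl
tpow≃t^ₚ (suc M) = ≃-trans tpow-suc (*ₚ-cong (≃-refl {t}) (tpow≃t^ₚ M))
  where
  tpow-suc : tpow (suc M) ≃ t *ₚ tpow M
  tpow-suc = coeffwise λ
    { zero    → sym (coeff-*ₚ t (tpow M) 0)
    ; (suc i) → sym (trans (coeff-0∷*ₚ 1ₚ (tpow M) i) (coeffwise-≡ (*ₚ-identityˡ (tpow M)) i)) }

tpow-^ₚ : ∀ M n → tpow M ^ₚ n ≃ tpow (n ℕ.* M)
tpow-^ₚ M n = begin
  tpow M ^ₚ n          ≈⟨ ^ₚ-congˡ n (tpow≃t^ₚ M) ⟩
  (t ^ₚ M) ^ₚ n        ≈⟨ ^ₚ-assocʳ t M n ⟩
  t ^ₚ (M ℕ.* n)       ≡⟨ cong (t ^ₚ_) (ℕP.*-comm M n) ⟩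
  t ^ₚ (n ℕ.* M)       ≈⟨ tpow≃t^ₚ (n ℕ.* M) ⟨
  tpow (n ℕ.* M)       ∎
  where open ≃-Reasoning

^ₚ-pred : ∀ f {n} → 0 ℕ.< n → f ^ₚ n ≡ f *ₚ f ^ₚ (n ∸ 1)
^ₚ-pred f {suc n} _ = refl

geometric : Poly → ℕ → Poly
geometric x zero    = 0ₚ
geometric x (suc L) = 1ₚ +ₚ x *ₚ geometric x L

geometric-sum : ∀ x L → (x -ₚ 1ₚ) *ₚ geometric x L ≃ x ^ₚ L -ₚ 1ₚ
geometric-sum x zero    = ≃-trans (*ₚ-zeroʳ (x -ₚ 1ₚ)) (≃-sym (-ₚ-inverseʳ 1ₚ))
geometric-sum x (suc L) = begin
  (x -ₚ 1ₚ) *ₚ (1ₚ +ₚ x *ₚ g)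
    ≈⟨ solve 2 (λ x g → (x :- con ℤ.1ℤ) :* (con ℤ.1ℤ :+ x :* g) := x :* ((x :- con ℤ.1ℤ) :* g) :+ (x :- con ℤ.1ℤ))
               ≃-refl x g ⟩
  x *ₚ ((x -ₚ 1ₚ) *ₚ g) +ₚ (x -ₚ 1ₚ)
    ≈⟨ +ₚ-cong (*ₚ-cong (≃-refl {x}) (geometric-sum x L)) (≃-refl {x -ₚ 1ₚ}) ⟩
  x *ₚ (x ^ₚ L -ₚ 1ₚ) +ₚ (x -ₚ 1ₚ)
    ≈⟨ solve 2 (λ x y → x :* (y :- con ℤ.1ℤ) :+ (x :- con ℤ.1ℤ) := x :* y :- con ℤ.1ℤ) ≃-refl x (x ^ₚ L) ⟩
  x *ₚ x ^ₚ L -ₚ 1ₚ ∎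
  where
  open ≃-Reasoning
  g = geometric x L

tpow-1-multiple : ∀ M L → tpow (L ℕ.* M) -ₚ 1ₚ ≃ (tpow M -ₚ 1ₚ) *ₚ geometric (tpow M) L
tpow-1-multiple M L = ≃-trans (+ₚ-cong (≃-sym (tpow-^ₚ M L)) (≃-refl {negₚ 1ₚ})) (≃-sym (geometric-sum (tpow M) L))

tpow-p^n-1-multiple : ∀ p {e n} → e ℕ.≤ n →
  tpow (p ^ n) -ₚ 1ₚ ≃ (tpow (p ^ e) -ₚ 1ₚ) *ₚ geometric (tpow (p ^ e)) (p ^ (n ∸ e))
tpow-p^n-1-multiple p {e} {n} e≤n =
  ≃-trans (≃-reflexive (cong (λ N → tpow N -ₚ 1ₚ) p^n≡p^[n-e]*p^e)) (tpow-1-multiple (p ^ e) (p ^ (n ∸ e)))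
  where
  p^n≡p^[n-e]*p^e : p ^ n ≡ p ^ (n ∸ e) ℕ.* p ^ e
  p^n≡p^[n-e]*p^e = trans (cong (p ^_) (sym (ℕP.m∸n+n≡m e≤n))) (ℕP.^-distribˡ-+-* p (n ∸ e) e)

-- Cancelling t^M - 1 modulo an integer

coeff-tpow*ₚ-below : ∀ M W {i} → i ℕ.< M → coeff (tpow M *ₚ W) i ≡ ℤ.0ℤ
coeff-tpow*ₚ-below (suc M) W {zero}  _         = coeff-*ₚ (tpow (suc M)) W 0
coeff-tpow*ₚ-below (suc M) W {suc i} (s≤s i<M) =
  trans (coeff-0∷*ₚ (tpow M) W i) (coeff-tpow*ₚ-below M W i<M)

coeff-tpow*ₚ-shift : ∀ M W j → coeff (tpow M *ₚ W) (M ℕ.+ j) ≡ coeff W j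
coeff-tpow*ₚ-shift zero    W j = coeffwise-≡ (*ₚ-identityˡ W) j
coeff-tpow*ₚ-shift (suc M) W j = trans (coeff-0∷*ₚ (tpow M) W (M ℕ.+ j)) (coeff-tpow*ₚ-shift M W j)

infix 4 _∣ₚ_

_∣ₚ_ : ℤ → Poly → Set
D ∣ₚ f = ∀ k → D ∣ coeff f k

≡0-mod-constₚ⇒∣ₚ : ∀ {D f} → f ≡ 0ₚ mod constₚ D → D ∣ₚ f
≡0-mod-constₚ⇒∣ₚ {D} {f} (congruent h e) k = divides (coeff h k) (begin
  coeff f k                ≡⟨ coeffwise-≡ (+ₚ-identityʳ f) k ⟨
  coeff (f -ₚ 0ₚ) k        ≡⟨ coeffwise-≡ e k ⟩
  coeff (constₚ D *ₚ h) k  ≡⟨ coeff-constₚ*ₚ D h k ⟩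
  D ℤ.* coeff h k          ≡⟨ ℤP.*-comm D (coeff h k) ⟩
  coeff h k ℤ.* D          ∎)
  where open ≡-Reasoning

∣ₚ⇒≡0-mod-constₚ : ∀ {D} f → D ∣ₚ f → f ≡ 0ₚ mod constₚ D
∣ₚ⇒≡0-mod-constₚ {D} f D∣f = congruent (quotients f D∣f) (coeffwise λ k →
  trans (coeffwise-≡ (+ₚ-identityʳ f) k) (sym (trans (coeff-constₚ*ₚ D (quotients f D∣f) k) (equation f D∣f k))))
  where
  quotients : ∀ f → D ∣ₚ f → Poly
  quotients []      _   = []
  quotients (a ∷ f) D∣f = _∣_.quotient (D∣f 0) ∷ quotients f (D∣f ∘ suc)
  equation : ∀ f D∣f → (λ k → D ℤ.* coeff (quotients f D∣f) k) ≗ coeff f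
  equation []      _   k       = ℤP.*-zeroʳ D
  equation (a ∷ f) D∣f zero    = trans (ℤP.*-comm D _) (sym (_∣_.equality (D∣f 0)))
  equation (a ∷ f) D∣f (suc k) = equation f (D∣f ∘ suc) k

-- The i-th coefficient of (t^(M+1) - 1) W is W_(i-M-1) - W_i (or -W_i for i ≤ M),
-- so D ∣ W_i follows by strong induction on i.
∣ₚ-cancel-tpow-1 : ∀ M {D} W → D ∣ₚ (tpow (suc M) -ₚ 1ₚ) *ₚ W → D ∣ₚ W
∣ₚ-cancel-tpow-1 M {D} W D∣ = <-rec (λ i → D ∣ coeff W i) step
  where
  T = tpow (suc M)
  D∣TW-W : ∀ i → D ∣ coeff (T *ₚ W) i ℤ.+ - coeff W i
  D∣TW-W i = subst (D ∣_) coeff-eq (D∣ i)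
    where
    coeff-eq : coeff ((T -ₚ 1ₚ) *ₚ W) i ≡ coeff (T *ₚ W) i ℤ.+ - coeff W i
    coeff-eq = begin
      coeff ((T -ₚ 1ₚ) *ₚ W) i
        ≡⟨ coeffwise-≡ (solve 2 (λ T W → (T :- con ℤ.1ℤ) :* W := T :* W :- W) ≃-refl T W) i ⟩
      coeff (T *ₚ W -ₚ W) i
        ≡⟨ coeff-+ₚ (T *ₚ W) (negₚ W) i ⟩
      coeff (T *ₚ W) i ℤ.+ coeff (negₚ W) i
        ≡⟨ cong (ℤ._+_ (coeff (T *ₚ W) i)) (coeff-negₚ W i) ⟩
      coeff (T *ₚ W) i ℤ.+ - coeff W i ∎
      where open ≡-Reasoning
  cancel : ∀ {a b} → D ∣ a ℤ.+ - b → D ∣ a → D ∣ b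
  cancel {b = b} D∣a-b D∣a = subst (D ∣_) (ℤP.neg-involutive b) (∣m⇒∣-m (∣m+n∣m⇒∣n D∣a-b D∣a))
  step : ∀ i → (∀ {j} → j ℕ.< i → D ∣ coeff W j) → D ∣ coeff W i
  step i rec with i ℕP.≤? M
  ... | yes i≤M = cancel (D∣TW-W i) (subst (D ∣_) (sym (coeff-tpow*ₚ-below (suc M) W (s≤s i≤M))) (divides ℤ.0ℤ refl))
  ... | no  i≰M with ℕP.m≤n⇒∃[o]m+o≡n (ℕP.≰⇒> i≰M)
  ...   | j , refl = cancel (D∣TW-W (suc M ℕ.+ j))
                       (subst (D ∣_) (sym (coeff-tpow*ₚ-shift (suc M) W j)) (rec (s≤s (ℕP.m≤n+m j M))))

tpow-1-cancel : ∀ {M} → 0 ℕ.< M → ∀ {D} W → (tpow M -ₚ 1ₚ) *ₚ W ≡ 0ₚ mod constₚ D → W ≡ 0ₚ mod constₚ D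
tpow-1-cancel {suc M} _ W = ∣ₚ⇒≡0-mod-constₚ W ∘ ∣ₚ-cancel-tpow-1 M W ∘ ≡0-mod-constₚ⇒∣ₚ

-- The Frobenius congruence

p∤j! : ∀ {p} → Prime p → ∀ {j} → j ℕ.< p → ¬ (p ℕ∣.∣ j !)
p∤j! pp {zero}  _    p∣1  = ¬prime[1] (subst Prime (ℕ∣.∣1⇒≡1 p∣1) pp)
p∤j! pp {suc j} j<p p∣j! with euclidsLemma (suc j) (j !) pp p∣j!
... | inj₁ p∣1+j = ℕP.<⇒≱ j<p (ℕ∣.∣⇒≤ p∣1+j)
... | inj₂ p∣j!  = p∤j! pp (ℕP.<-trans (ℕP.n<1+n j) j<p) p∣j!

-- p divides p! = (p C k) * (k! (p-k)!) but neither factorial.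
p∣pCk : ∀ {p} → Prime p → ∀ {k} → 0 ℕ.< k → k ℕ.< p → p ℕ∣.∣ p C k
p∣pCk {suc q} pp {k} 0<k k<p with euclidsLemma (suc q C k) (k ! ℕ.* (suc q ∸ k) !) pp p∣product
  where
  p = suc q
  instance _ = ℕP._!*_!≢0 k (p ∸ k)
  p∣product : p ℕ∣.∣ (p C k) ℕ.* (k ! ℕ.* (p ∸ k) !)
  p∣product = subst (p ℕ∣.∣_)
    (sym (trans (cong (ℕ._* (k ! ℕ.* (p ∸ k) !)) (nCk≡n!/k![n-k]! (ℕP.<⇒≤ k<p)))
                (m/n*n≡m (k![n∸k]!∣n! (ℕP.<⇒≤ k<p)))))
    (ℕ∣.m∣m*n (q !))
... | inj₁ p∣C = p∣C
... | inj₂ p∣k![p-k]! with euclidsLemma (k !) ((suc q ∸ k) !) pp p∣k![p-k]!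
...   | inj₁ p∣k!     = ⊥-elim (p∤j! pp k<p p∣k!)
...   | inj₂ p∣[p-k]! = ⊥-elim (p∤j! pp (ℕP.∸-monoʳ-< 0<k (ℕP.<⇒≤ k<p)) p∣[p-k]!)

open Mult (CommutativeRing.semiring Poly-commutativeRing) using (_×_)
open Sum (CommutativeRing.+-monoid Poly-commutativeRing) using (sum; sum-init-last)
open Binomial (CommutativeRing.commutativeSemiring Poly-commutativeRing)
  using (binomialTerm) renaming (theorem to binomial-theorem)

×≃constₚ*ₚ : ∀ n f → n × f ≃ constₚ (+ n) *ₚ f
×≃constₚ*ₚ n f = coeffwise λ k → trans (coeff-× n k) (sym (coeff-constₚ*ₚ (+ n) f k))
  where
  coeff-× : ∀ n k → coeff (n × f) k ≡ + n ℤ.* coeff f k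
  coeff-× zero    k = sym (ℤP.*-zeroˡ (coeff f k))
  coeff-× (suc n) k = begin
    coeff (f +ₚ n × f) k                 ≡⟨ coeff-+ₚ f (n × f) k ⟩
    coeff f k ℤ.+ coeff (n × f) k        ≡⟨ cong (ℤ._+_ (coeff f k)) (coeff-× n k) ⟩
    coeff f k ℤ.+ + n ℤ.* coeff f k      ≡⟨ ℤP.suc-* (+ n) (coeff f k) ⟨
    + suc n ℤ.* coeff f k                ∎
    where open ≡-Reasoning

×≡0 : ∀ {p n} f → p ℕ∣.∣ n → n × f ≡ 0ₚ mod constₚ (+ p)
×≡0 {p} {n} f (ℕ∣.divides m refl) = congruent (constₚ (+ m) *ₚ f) (begin
  (m ℕ.* p) × f -ₚ 0ₚ
    ≈⟨ +ₚ-identityʳ ((m ℕ.* p) × f) ⟩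
  (m ℕ.* p) × f
    ≈⟨ ×≃constₚ*ₚ (m ℕ.* p) f ⟩
  constₚ (+ (m ℕ.* p)) *ₚ f
    ≡⟨ cong (λ c → constₚ c *ₚ f) (ℤP.pos-* m p) ⟩
  constₚ (+ m ℤ.* + p) *ₚ f
    ≈⟨ *ₚ-cong (constₚ-* (+ m) (+ p)) (≃-refl {f}) ⟩
  (constₚ (+ m) *ₚ constₚ (+ p)) *ₚ f
    ≈⟨ solve 3 (λ a b f → (a :* b) :* f := b :* (a :* f)) ≃-refl (constₚ (+ m)) (constₚ (+ p)) f ⟩
  constₚ (+ p) *ₚ (constₚ (+ m) *ₚ f) ∎)
  where open ≃-Reasoning

∑≡0 : ∀ {c} n (f : Fin n → Poly) → (∀ i → f i ≡ 0ₚ mod c) → sum f ≡ 0ₚ mod c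
∑≡0 zero    f f≡0 = ≡mod-refl
∑≡0 (suc n) f f≡0 = ≡mod-+-cong (f≡0 Fin.zero) (∑≡0 n (f ∘ Fin.suc) (f≡0 ∘ Fin.suc))

freshman's-dream : ∀ {p} → Prime p → ∀ x y → (x +ₚ y) ^ₚ p ≡ x ^ₚ p +ₚ y ^ₚ p mod constₚ (+ p)
freshman's-dream {zero}  pp = ⊥-elim (¬prime[0] pp)
freshman's-dream {suc q} pp x y = begin
  (x +ₚ y) ^ₚ p
    ≡⟨ ^ₚ≡^ᴿ (x +ₚ y) p ⟩
  (x +ₚ y) ^ᴿ p
    ≃⟨ binomial-theorem p x y ⟩
  term Fin.zero +ₚ sum (term ∘ Fin.suc)
    ≃⟨ +ₚ-cong (≃-refl {term Fin.zero}) (sum-init-last (term ∘ Fin.suc)) ⟩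
  term Fin.zero +ₚ (sum middle +ₚ term last)
    ≈⟨ ≡mod-+-cong (≡mod-refl {f = term Fin.zero}) (≡mod-+-cong (∑≡0 q middle middle≡0) (≡mod-refl {f = term last})) ⟩
  term Fin.zero +ₚ term last
    ≃⟨ +ₚ-cong term-first term-last ⟩
  y ^ₚ p +ₚ x ^ₚ p
    ≃⟨ +ₚ-comm (y ^ₚ p) (x ^ₚ p) ⟩
  x ^ₚ p +ₚ y ^ₚ p ∎
  where
  open ≡mod-Reasoning (constₚ (+ suc q))
  p = suc q
  term = binomialTerm x y p
  last = Fin.suc (fromℕ q)
  middle : Fin q → Poly
  middle i = term (Fin.suc (inject₁ i))
  middle≡0 : ∀ i → middle i ≡ 0ₚ mod constₚ (+ p)
  middle≡0 i = ×≡0 _ (p∣pCk pp (s≤s z≤n) (s≤s (subst (ℕ._< q) (sym (FinP.toℕ-inject₁ i)) (FinP.toℕ<n i))))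
  term-first : term Fin.zero ≃ y ^ₚ p
  term-first = ≃-trans (+ₚ-identityʳ _) (≃-trans (*ₚ-identityˡ _) (≃-reflexive (sym (^ₚ≡^ᴿ y p))))
  term-last : term last ≃ x ^ₚ p
  term-last rewrite FinP.toℕ-fromℕ q | nCn≡1 p | ℕP.n∸n≡0 p =
    ≃-trans (+ₚ-identityʳ _) (≃-trans (*ₚ-identityʳ _) (≃-reflexive (sym (^ₚ≡^ᴿ x p))))

-- With F = t^N - 1: (u^N)^p ≡ F^p by induction, and F^p + 1 ≡ (F + 1)^p = t^(pN)
-- by the freshman's dream.
frobenius : ∀ {p} → Prime p → ∀ e → (t -ₚ 1ₚ) ^ₚ (p ^ e) ≡ tpow (p ^ e) -ₚ 1ₚ mod constₚ (+ p)
frobenius pp zero    = ≃⇒≡mod (*ₚ-identityʳ (t -ₚ 1ₚ))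
frobenius {p} pp (suc e) = begin
  u ^ₚ (p ℕ.* N)
    ≡⟨ cong (u ^ₚ_) (ℕP.*-comm p N) ⟩
  u ^ₚ (N ℕ.* p)
    ≃⟨ ≃-sym (^ₚ-assocʳ u N p) ⟩
  (u ^ₚ N) ^ₚ p
    ≈⟨ ≡mod-^-cong p (frobenius pp e) ⟩
  F ^ₚ p
    ≃⟨ solve 2 (λ a b → a := (a :+ b) :- b) ≃-refl (F ^ₚ p) (1ₚ ^ₚ p) ⟩
  (F ^ₚ p +ₚ 1ₚ ^ₚ p) -ₚ 1ₚ ^ₚ p
    ≈⟨ ≡mod-+-cong (≡mod-sym (freshman's-dream pp F 1ₚ)) (≡mod-refl {f = negₚ (1ₚ ^ₚ p)}) ⟩
  (F +ₚ 1ₚ) ^ₚ p -ₚ 1ₚ ^ₚ p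
    ≃⟨ +ₚ-cong (^ₚ-congˡ p F+1≃t^N) (negₚ-cong (1ₚ^ₚ p)) ⟩
  tpow N ^ₚ p -ₚ 1ₚ
    ≃⟨ +ₚ-cong (tpow-^ₚ N p) (≃-refl {negₚ 1ₚ}) ⟩
  tpow (p ℕ.* N) -ₚ 1ₚ ∎
  where
  open ≡mod-Reasoning (constₚ (+ p))
  u = t -ₚ 1ₚ
  N = p ^ e
  F = tpow N -ₚ 1ₚ
  F+1≃t^N : F +ₚ 1ₚ ≃ tpow N
  F+1≃t^N = solve 1 (λ a → (a :- con ℤ.1ℤ) :+ con ℤ.1ℤ := a) ≃-refl (tpow N)

frobenius′ : ∀ {p} → Prime p → ∀ e →
  (t -ₚ 1ₚ) *ₚ (t -ₚ 1ₚ) ^ₚ (p ^ e ∸ 1) ≡ tpow (p ^ e) -ₚ 1ₚ mod constₚ (+ p)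
frobenius′ {p} pp e = subst (λ f → f ≡ tpow (p ^ e) -ₚ 1ₚ mod constₚ (+ p))
  (^ₚ-pred (t -ₚ 1ₚ) (ℕP.m^n>0 p {{prime⇒nonZero pp}} e)) (frobenius pp e)

-- Components in the free module on y, x_0, …, x_{m-1}

sum≃0 : ∀ {n} (f : Fin n → Poly) → (∀ i → f i ≃ 0ₚ) → sum f ≃ 0ₚ
sum≃0 {zero}  f f≃0 = ≃-refl
sum≃0 {suc n} f f≃0 = +ₚ-cong (f≃0 Fin.zero) (sum≃0 (f ∘ Fin.suc) (f≃0 ∘ Fin.suc))

sum-single : ∀ {n} (f : Fin n → Poly) i₀ → (∀ i → i ≢ i₀ → f i ≃ 0ₚ) → sum f ≃ f i₀
sum-single f Fin.zero f≃0 = ≃-trans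
  (+ₚ-cong (≃-refl {f Fin.zero}) (sum≃0 (f ∘ Fin.suc) (λ i → f≃0 (Fin.suc i) λ ())))
  (+ₚ-identityʳ (f Fin.zero))
sum-single f (Fin.suc i₀) f≃0 = +ₚ-cong (f≃0 Fin.zero λ ())
  (sum-single (f ∘ Fin.suc) i₀ (λ i i≢i₀ → f≃0 (Fin.suc i) (i≢i₀ ∘ FinP.suc-injective)))

ycomp-sumₑ : ∀ {m k} (h : Fin k → Elem m) → ycomp (sumₑ h) ≡ sum (ycomp ∘ h)
ycomp-sumₑ {k = zero}  h = refl
ycomp-sumₑ {k = suc k} h = cong (ycomp (h Fin.zero) +ₚ_) (ycomp-sumₑ (h ∘ Fin.suc))

xcomp-sumₑ : ∀ {m k} (h : Fin k → Elem m) j → xcomp (sumₑ h) j ≡ sum (λ i → xcomp (h i) j)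
xcomp-sumₑ {k = zero}  h j = refl
xcomp-sumₑ {k = suc k} h j = cong (xcomp (h Fin.zero) j +ₚ_) (xcomp-sumₑ (h ∘ Fin.suc) j)

record SupportedOn {m} (i : Fin m) (u : Elem m) : Set where
  field
    ycomp≃0 : ycomp u ≃ 0ₚ
    xcomp≃0 : ∀ {j} → i ≢ j → xcomp u j ≃ 0ₚ

open SupportedOn

xcomp-genX-self : ∀ {m} (i : Fin m) → xcomp (genX i) i ≡ 1ₚ
xcomp-genX-self Fin.zero    = refl
xcomp-genX-self (Fin.suc i) = xcomp-genX-self i

genX-supported : ∀ {m} (i : Fin m) → SupportedOn i (genX i)
genX-supported i = record { ycomp≃0 = ≃-refl ; xcomp≃0 = λ i≢j → ≃-reflexive (xcomp-genX-other i≢j) }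
  where
  xcomp-genX-other : ∀ {m} {i j : Fin m} → i ≢ j → xcomp (genX i) j ≡ 0ₚ
  xcomp-genX-other {i = Fin.zero}  {Fin.zero}  i≢j = ⊥-elim (i≢j refl)
  xcomp-genX-other {i = Fin.zero}  {Fin.suc j} i≢j = refl
  xcomp-genX-other {i = Fin.suc i} {Fin.zero}  i≢j = refl
  xcomp-genX-other {i = Fin.suc i} {Fin.suc j} i≢j = xcomp-genX-other (i≢j ∘ cong Fin.suc)

·ₑ-supported : ∀ {m} {i : Fin m} {u} f → SupportedOn i u → SupportedOn i (f ·ₑ u)
·ₑ-supported f u-on-i = record
  { ycomp≃0 = ≃-trans (*ₚ-cong (≃-refl {f}) (ycomp≃0 u-on-i)) (*ₚ-zeroʳ f)
  ; xcomp≃0 = λ i≢j → ≃-trans (*ₚ-cong (≃-refl {f}) (xcomp≃0 u-on-i i≢j)) (*ₚ-zeroʳ f) }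

module _ {m} (h : Fin m → Elem m) (supported : ∀ i → SupportedOn i (h i)) where

  ycomp-sumₑ-supported : ycomp (sumₑ h) ≃ 0ₚ
  ycomp-sumₑ-supported = ≃-trans (≃-reflexive (ycomp-sumₑ h)) (sum≃0 (ycomp ∘ h) (ycomp≃0 ∘ supported))

  xcomp-sumₑ-supported : ∀ j → xcomp (sumₑ h) j ≃ xcomp (h j) j
  xcomp-sumₑ-supported j = ≃-trans (≃-reflexive (xcomp-sumₑ h j))
    (sum-single (λ i → xcomp (h i) j) j (λ i i≢j → xcomp≃0 (supported i) i≢j))

-- The argument, for abstract p, P = p^(m-1), Pm = p^m, F = σ^M - 1,
-- T = σ^(p^n) - 1, x = σ - d, u = σ - 1 and U = u^(M-1)

module TopCoefficient
  {p P Pm F T S x u U : Poly}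
  (Pm≃pP    : Pm ≃ p *ₚ P)
  (T≃FS     : T ≃ F *ₚ S)
  (F-cancel : ∀ W → F *ₚ W ≡ 0ₚ mod P → W ≡ 0ₚ mod P)
  (u-cancel : ∀ W → u *ₚ W ≡ 0ₚ mod p → W ≡ 0ₚ mod p)
  (x≡u      : x ≡ u mod p)
  (uU≡F     : u *ₚ U ≡ F mod p)
  where

  -- F W ≡ 0 modulo P and F is not a zero divisor modulo P, so W = w + S r is a multiple of P.
  x-step : ∀ g c w r → P *ₚ g ≡ P *ₚ c +ₚ F *ₚ w +ₚ T *ₚ r mod Pm →
           Σ Poly λ w′ → P *ₚ g ≡ P *ₚ c +ₚ F *ₚ (P *ₚ w′) mod Pm
  x-step g c w r hx = _≡_mod_.quotient W≡0 , ≡mod-trans hx′ (≃⇒≡mod W≃Pw′)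
    where
    W = w +ₚ S *ₚ r
    hx′ : P *ₚ g ≡ P *ₚ c +ₚ F *ₚ W mod Pm
    hx′ = ≡mod-trans hx (≃⇒≡mod (begin
      P *ₚ c +ₚ F *ₚ w +ₚ T *ₚ r
        ≈⟨ +ₚ-cong (≃-refl {P *ₚ c +ₚ F *ₚ w}) (*ₚ-cong T≃FS (≃-refl {r})) ⟩
      P *ₚ c +ₚ F *ₚ w +ₚ (F *ₚ S) *ₚ r
        ≈⟨ solve 6 (λ P c F w S r → P :* c :+ F :* w :+ (F :* S) :* r := P :* c :+ F :* (w :+ S :* r)) ≃-refl P c F w S r ⟩
      P *ₚ c +ₚ F *ₚ W ∎))
      where open ≃-Reasoning
    FW≡0 : F *ₚ W ≡ 0ₚ mod P
    FW≡0 = begin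
      F *ₚ W
        ≃⟨ solve 3 (λ F W Pc → F :* W := (Pc :+ F :* W) :- Pc) ≃-refl F W (P *ₚ c) ⟩
      (P *ₚ c +ₚ F *ₚ W) -ₚ P *ₚ c
        ≈⟨ ≡mod-+-cong (≡mod-sym (≡mod-divisor p Pm≃pP hx′)) (≡mod-refl {f = negₚ (P *ₚ c)}) ⟩
      P *ₚ g -ₚ P *ₚ c
        ≃⟨ solve 3 (λ P g c → P :* g :- P :* c := P :* (g :- c)) ≃-refl P g c ⟩
      P *ₚ (g -ₚ c)
        ≈⟨ multiple≡0 P (g -ₚ c) ⟩
      0ₚ ∎
      where open ≡mod-Reasoning P
    W≡0 = F-cancel W FW≡0
    W≃Pw′ : P *ₚ c +ₚ F *ₚ W ≃ P *ₚ c +ₚ F *ₚ (P *ₚ _≡_mod_.quotient W≡0)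
    W≃Pw′ = +ₚ-cong (≃-refl {P *ₚ c}) (*ₚ-cong (≃-refl {F}) (≡mod⇒≃ W≡0))

  -- Modulo p, u (c - U Z) ≡ c x - F Z ≡ 0, and u is not a zero divisor modulo p.
  y-step : ∀ c Y r → F *ₚ Y ≡ c *ₚ x +ₚ T *ₚ r mod Pm → Σ Poly λ Z → c ≡ U *ₚ Z mod p
  y-step c Y r hy = Z , -≡0⇒≡ (u-cancel (c -ₚ U *ₚ Z) u[c-UZ]≡0)
    where
    open ≡mod-Reasoning p
    Z = Y -ₚ S *ₚ r
    Pm≃Pp : Pm ≃ P *ₚ p
    Pm≃Pp = ≃-trans Pm≃pP (*ₚ-comm p P)
    cx≡FZ : c *ₚ x ≡ F *ₚ Z mod p
    cx≡FZ = begin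
      c *ₚ x
        ≃⟨ solve 2 (λ a b → a := (a :+ b) :- b) ≃-refl (c *ₚ x) (T *ₚ r) ⟩
      (c *ₚ x +ₚ T *ₚ r) -ₚ T *ₚ r
        ≈⟨ ≡mod-+-cong (≡mod-sym (≡mod-divisor P Pm≃Pp hy)) (≡mod-refl {f = negₚ (T *ₚ r)}) ⟩
      F *ₚ Y -ₚ T *ₚ r
        ≃⟨ +ₚ-cong (≃-refl {F *ₚ Y}) (negₚ-cong (*ₚ-cong T≃FS (≃-refl {r}))) ⟩
      F *ₚ Y -ₚ (F *ₚ S) *ₚ r
        ≃⟨ solve 4 (λ F Y S r → F :* Y :- (F :* S) :* r := F :* (Y :- S :* r)) ≃-refl F Y S r ⟩
      F *ₚ Z ∎
    u[c-UZ]≡0 : u *ₚ (c -ₚ U *ₚ Z) ≡ 0ₚ mod p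
    u[c-UZ]≡0 = begin
      u *ₚ (c -ₚ U *ₚ Z)
        ≃⟨ solve 4 (λ u c U Z → u :* (c :- U :* Z) := c :* u :- (u :* U) :* Z) ≃-refl u c U Z ⟩
      c *ₚ u -ₚ (u *ₚ U) *ₚ Z
        ≈⟨ ≡mod-+-cong (≡mod-*-cong (≡mod-refl {f = c}) (≡mod-sym x≡u))
                       (≡mod-neg-cong (≡mod-*-cong uU≡F (≡mod-refl {f = Z}))) ⟩
      c *ₚ x -ₚ F *ₚ Z
        ≈⟨ ≡mod-+-cong cx≡FZ (≡mod-refl {f = negₚ (F *ₚ Z)}) ⟩
      F *ₚ Z -ₚ F *ₚ Z
        ≃⟨ -ₚ-inverseʳ (F *ₚ Z) ⟩
      0ₚ ∎

  top-coefficient : ∀ g c w r₁ Y r₂ →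
    P *ₚ g ≡ P *ₚ c +ₚ F *ₚ w +ₚ T *ₚ r₁ mod Pm →
    F *ₚ Y ≡ c *ₚ x +ₚ T *ₚ r₂ mod Pm →
    Σ Poly λ h → P *ₚ g ≡ h *ₚ (P *ₚ U) mod Pm
  top-coefficient g c w r₁ Y r₂ hx hy = Z +ₚ u *ₚ w′ , (begin
    P *ₚ g
      ≈⟨ hx′ ⟩
    P *ₚ c +ₚ F *ₚ (P *ₚ w′)
      ≃⟨ +ₚ-cong (*ₚ-comm P c) (≃-refl {F *ₚ (P *ₚ w′)}) ⟩
    c *ₚ P +ₚ F *ₚ (P *ₚ w′)
      ≈⟨ ≡mod-+-cong (≡mod-divisor 1ₚ pP≃Pm (≡mod-*ʳ P c≡UZ))
                     (≡mod-divisor w′ p[Pw′]≃w′Pm (≡mod-*ʳ (P *ₚ w′) (≡mod-sym uU≡F))) ⟩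
    (U *ₚ Z) *ₚ P +ₚ (u *ₚ U) *ₚ (P *ₚ w′)
      ≃⟨ solve 5 (λ U Z P u w′ → (U :* Z) :* P :+ (u :* U) :* (P :* w′) := (Z :+ u :* w′) :* (P :* U))
                 ≃-refl U Z P u w′ ⟩
    (Z +ₚ u *ₚ w′) *ₚ (P *ₚ U) ∎)
    where
    open ≡mod-Reasoning Pm
    w′ = proj₁ (x-step g c w r₁ hx)
    hx′ = proj₂ (x-step g c w r₁ hx)
    Z = proj₁ (y-step c Y r₂ hy)
    c≡UZ = proj₂ (y-step c Y r₂ hy)
    pP≃Pm : p *ₚ P ≃ 1ₚ *ₚ Pm
    pP≃Pm = ≃-trans (≃-sym Pm≃pP) (≃-sym (*ₚ-identityˡ Pm))
    p[Pw′]≃w′Pm : p *ₚ (P *ₚ w′) ≃ w′ *ₚ Pm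
    p[Pw′]≃w′Pm = ≃-trans (solve 3 (λ p P w′ → p :* (P :* w′) := w′ :* (p :* P)) ≃-refl p P w′)
                          (*ₚ-cong (≃-refl {w′}) (≃-sym Pm≃pP))

EqG⇒≡mod : ∀ {p n m f g} → EqG p n m f g →
  Σ Poly λ r → f ≡ g +ₚ (tpow (p ^ n) -ₚ 1ₚ) *ₚ r mod constₚ (+ (p ^ m))
EqG⇒≡mod {p} {n} {m} {f} {g} (q , r , e) = r , congruent q (begin
  f -ₚ (g +ₚ T *ₚ r)
    ≈⟨ solve 3 (λ f g Tr → f :- (g :+ Tr) := (f :- g) :- Tr) ≃-refl f g (T *ₚ r) ⟩
  (f -ₚ g) -ₚ T *ₚ r
    ≈⟨ +ₚ-cong (coeffwise e) (≃-refl {negₚ (T *ₚ r)}) ⟩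
  (Pm *ₚ q +ₚ T *ₚ r) -ₚ T *ₚ r
    ≈⟨ solve 2 (λ a b → (a :+ b) :- b := a) ≃-refl (Pm *ₚ q) (T *ₚ r) ⟩
  Pm *ₚ q ∎)
  where
  open ≃-Reasoning
  T = tpow (p ^ n) -ₚ 1ₚ
  Pm = constₚ (+ (p ^ m))

≡mod⇒EqG : ∀ {p n m f g} → f ≡ g mod constₚ (+ (p ^ m)) → EqG p n m f g
≡mod⇒EqG {p} {n} {m} (congruent q e) = q , 0ₚ , coeffwise-≡ (≃-trans e (≃-sym (begin
  Pm *ₚ q +ₚ T *ₚ 0ₚ     ≈⟨ +ₚ-cong (≃-refl {Pm *ₚ q}) (*ₚ-zeroʳ T) ⟩
  Pm *ₚ q +ₚ 0ₚ          ≈⟨ +ₚ-identityʳ (Pm *ₚ q) ⟩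
  Pm *ₚ q                ∎)))
  where
  open ≃-Reasoning
  T = tpow (p ^ n) -ₚ 1ₚ
  Pm = constₚ (+ (p ^ m))

module ComponentEquations
  (p n : ℕ) (d : ℤ) {m} (a : Fin m → Ext) (l e : ℕ)
  (v : Elem m) (g : Fin m → Poly) (c : Poly) (s : Fin m → Poly)
  where

  P F T Pm : Poly
  P  = constₚ (+ (p ^ l))
  F  = tpow (p ^ e) -ₚ 1ₚ
  T  = tpow (p ^ n) -ₚ 1ₚ
  Pm = constₚ (+ (p ^ m))

  gx pⁱx sx : Fin m → Elem m
  gx i  = g i ·ₑ genX i
  pⁱx i = constₚ (+ (p ^ toℕ i)) ·ₑ genX i
  sx i  = s i ·ₑ relX p a i

  lhs rhs : Elem m
  lhs = (F ·ₑ v) -ₑ (P ·ₑ sumₑ gx)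
  rhs = (c ·ₑ relY p d m) +ₑ sumₑ sx

  private
    gx-supported : ∀ i → SupportedOn i (gx i)
    gx-supported i = ·ₑ-supported (g i) (genX-supported i)
    pⁱx-supported : ∀ i → SupportedOn i (pⁱx i)
    pⁱx-supported i = ·ₑ-supported (constₚ (+ (p ^ toℕ i))) (genX-supported i)
    sx-supported : ∀ i → SupportedOn i (sx i)
    sx-supported i = ·ₑ-supported (s i) (·ₑ-supported (σpow p (a i) -ₚ 1ₚ) (genX-supported i))

  y-equation : EqG p n m (ycomp lhs) (ycomp rhs) →
               Σ Poly λ r → F *ₚ ycomp v ≡ c *ₚ (t -ₚ constₚ d) +ₚ T *ₚ r mod Pm
  y-equation eq = r , ≡mod-resp-≃ lhs≃ rhs≃ eq′
    where
    r = proj₁ (EqG⇒≡mod {p} {n} {m} {ycomp lhs} {ycomp rhs} eq)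
    eq′ = proj₂ (EqG⇒≡mod {p} {n} {m} {ycomp lhs} {ycomp rhs} eq)
    Y₀ = ycomp (sumₑ pⁱx)
    S₀ = ycomp (sumₑ sx)
    x = t -ₚ constₚ d
    lhs≃ : ycomp lhs ≃ F *ₚ ycomp v
    lhs≃ = ≃-trans
      (+ₚ-cong (≃-refl {F *ₚ ycomp v})
               (negₚ-cong (≃-trans (*ₚ-cong (≃-refl {P}) (ycomp-sumₑ-supported gx gx-supported)) (*ₚ-zeroʳ P))))
      (+ₚ-identityʳ (F *ₚ ycomp v))
    rhs≃ : ycomp rhs +ₚ T *ₚ r ≃ c *ₚ x +ₚ T *ₚ r
    rhs≃ = begin
      c *ₚ (x *ₚ 1ₚ -ₚ Y₀) +ₚ S₀ +ₚ T *ₚ r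
        ≈⟨ +ₚ-cong (+ₚ-cong (*ₚ-cong (≃-refl {c}) (+ₚ-cong (≃-refl {x *ₚ 1ₚ}) (negₚ-cong Y₀≃0)))
                            (≃-trans (ycomp-sumₑ-supported sx sx-supported) 0ₚ≃constₚ0))
                   (≃-refl {T *ₚ r}) ⟩
      c *ₚ (x *ₚ 1ₚ -ₚ constₚ ℤ.0ℤ) +ₚ constₚ ℤ.0ℤ +ₚ T *ₚ r
        ≈⟨ solve 3 (λ c x Tr → c :* (x :* con ℤ.1ℤ :- con ℤ.0ℤ) :+ con ℤ.0ℤ :+ Tr := c :* x :+ Tr) ≃-refl c x (T *ₚ r) ⟩
      c *ₚ x +ₚ T *ₚ r ∎
      where
      open ≃-Reasoning
      Y₀≃0 : Y₀ ≃ constₚ ℤ.0ℤ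
      Y₀≃0 = ≃-trans (ycomp-sumₑ-supported pⁱx pⁱx-supported) 0ₚ≃constₚ0

  x-equation : ∀ j → toℕ j ≡ l → a j ≡ fin e → EqG p n m (xcomp lhs j) (xcomp rhs j) →
               Σ Poly λ w → Σ Poly λ r → P *ₚ g j ≡ P *ₚ c +ₚ F *ₚ w +ₚ T *ₚ r mod Pm
  x-equation j refl aj≡e eq = xcomp v j -ₚ s j , negₚ r , (begin
    P *ₚ g j
      ≃⟨ solve 2 (λ a b → b := a :- (a :- b)) ≃-refl (F *ₚ xcomp v j) (P *ₚ g j) ⟩
    F *ₚ xcomp v j -ₚ (F *ₚ xcomp v j -ₚ P *ₚ g j)
      ≈⟨ ≡mod-+-cong (≡mod-refl {f = F *ₚ xcomp v j}) (≡mod-neg-cong eq′) ⟩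
    F *ₚ xcomp v j -ₚ (c *ₚ negₚ P +ₚ s j *ₚ F +ₚ T *ₚ r)
      ≃⟨ solve 6 (λ F vj c P sj Tr → F :* vj :- (c :* (:- P) :+ sj :* F :+ Tr) := P :* c :+ F :* (vj :- sj) :+ :- Tr)
                 ≃-refl F (xcomp v j) c P (s j) (T *ₚ r) ⟩
    P *ₚ c +ₚ F *ₚ (xcomp v j -ₚ s j) +ₚ negₚ (T *ₚ r)
      ≃⟨ +ₚ-cong (≃-refl {P *ₚ c +ₚ F *ₚ (xcomp v j -ₚ s j)}) (solve 2 (λ T r → :- (T :* r) := T :* (:- r)) ≃-refl T r) ⟩
    P *ₚ c +ₚ F *ₚ (xcomp v j -ₚ s j) +ₚ T *ₚ negₚ r ∎)
    where
    open ≡mod-Reasoning Pm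
    r = proj₁ (EqG⇒≡mod {p} {n} {m} {xcomp lhs j} {xcomp rhs j} eq)
    diagonal : ∀ {f} → f *ₚ xcomp (genX j) j ≃ f
    diagonal {f} = ≃-trans (*ₚ-cong (≃-refl {f}) (≃-reflexive (xcomp-genX-self j))) (*ₚ-identityʳ f)
    lhs≃ : xcomp lhs j ≃ F *ₚ xcomp v j -ₚ P *ₚ g j
    lhs≃ = +ₚ-cong (≃-refl {F *ₚ xcomp v j})
      (negₚ-cong (*ₚ-cong (≃-refl {P}) (≃-trans (xcomp-sumₑ-supported gx gx-supported j) diagonal)))
    rhs≃ : xcomp rhs j +ₚ T *ₚ r ≃ c *ₚ negₚ P +ₚ s j *ₚ F +ₚ T *ₚ r
    rhs≃ = +ₚ-cong
      (+ₚ-cong (*ₚ-cong (≃-refl {c}) (+ₚ-cong (*ₚ-zeroʳ (t -ₚ constₚ d))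
                                              (negₚ-cong (≃-trans (xcomp-sumₑ-supported pⁱx pⁱx-supported j) diagonal))))
               (≃-trans (xcomp-sumₑ-supported sx sx-supported j)
                        (*ₚ-cong (≃-refl {s j}) (≃-trans diagonal (≃-reflexive (cong (λ b → σpow p b -ₚ 1ₚ) aj≡e))))))
      (≃-refl {T *ₚ r})
    eq′ : F *ₚ xcomp v j -ₚ P *ₚ g j ≡ c *ₚ negₚ P +ₚ s j *ₚ F +ₚ T *ₚ r mod Pm
    eq′ = ≡mod-resp-≃ lhs≃ rhs≃ (proj₂ (EqG⇒≡mod {p} {n} {m} {xcomp lhs j} {xcomp rhs j} eq))

-- Only condition (I), d ≡ 1 mod p, is needed.
lemma4p2 : (p : ℕ) → Prime p → (n k : ℕ) → (d : ℤ) →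
    (a : Fin (2 + k) → Ext) → (∀ i → InRange n (a i)) →
    CondI p d → CondII p d (2 + k) a → CondIII p d (2 + k) a →
    CondIV p n a → CondV p d a →
    (e : ℕ) → a (fromℕ (1 + k)) ≡ fin e →
    (v : Elem (2 + k)) → (g : Fin (2 + k) → Poly) →
    EqX p n d (2 + k) a
      ((σpow p (fin e) -ₚ 1ₚ) ·ₑ v)
      (constₚ (+ (p ^ (1 + k))) ·ₑ sumₑ (λ i → g i ·ₑ genX i)) →
    InIdealG p n (2 + k)
      (constₚ (+ (p ^ (1 + k))) *ₚ ((t -ₚ 1ₚ) ^ₚ ((p ^ e) ∸ 1)))
      (constₚ (+ (p ^ (1 + k))) *ₚ g (fromℕ (1 + k)))
lemma4p2 p pp n k d a in-range d∈U₁ _ _ _ _ e a[k+1]≡e v g (c , s , y-eq , x-eqs) =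
  proj₁ top , ≡mod⇒EqG {p} {n} {2 + k} (proj₂ top)
  where
  open ComponentEquations p n d a (1 + k) e v g c s
  open TopCoefficient (constₚ-p^suc p (1 + k))
    (tpow-p^n-1-multiple p (subst (InRange n) a[k+1]≡e (in-range (fromℕ (1 + k)))))
    (tpow-1-cancel (ℕP.m^n>0 p {{prime⇒nonZero pp}} e)) (tpow-1-cancel {1} (s≤s z≤n))
    (t-d≡t-1 p d d∈U₁) (frobenius′ pp e)
  L = fromℕ (1 + k)
  y-eqn = y-equation y-eq
  x-eqn = x-equation L (FinP.toℕ-fromℕ (1 + k)) a[k+1]≡e (x-eqs L)
  top = top-coefficient (g L) c (proj₁ x-eqn) (proj₁ (proj₂ x-eqn)) (ycomp v) (proj₁ y-eqn)
          (proj₂ (proj₂ x-eqn)) (proj₂ y-eqn)
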